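{- Let $a$ and $t$ be odd integers and let $c \geq 0$ be an integer. Suppose there exists a positive integer $b$ with $t \not\equiv \pm 1 \pmod{2^b}$, and let $b$ be the smallest such positive integer. Define the sequence $\mathbf{s} = (s(n))_{n \geq 0}$ by $$s(n) = a\,\frac{(t^2)^{n+c} - 1}{2^b}.$$ Then for all integers $n \geq 1$, the discriminator of $\mathbf{s}$ satisfies $D_{\mathbf{s}}(n) = 2^{\lceil \log_2 n \rceil}$.
   Context: A positive integer $m$ discriminates a set $S$ of integers if the elements of $S$ are pairwise incongruent modulo $m$. For a sequence $\mathbf{s} = (s(i))_{i \geq 0}$ of distinct integers and an integer $n \geq 1$, the discriminator $D_{\mathbf{s}}(n)$ is the least positive integer $m$ that discriminates the set $\{s(0), s(1), \ldots, s(n-1)\}$. -}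

module Defs where

open import Data.Nat as ℕ using (ℕ; suc; zero)
open import Data.Integer as ℤ using (ℤ; +_)
open import Data.Integer.Divisibility using (_∣_)
open import Data.Integer.DivMod using (_/ℕ_)
open import Data.Nat.Properties using (m^n≢0)
open import Data.Nat.Logarithm using (⌈log₂_⌉)
open import Data.Product using (Σ; _×_)
open import Relation.Nullary using (¬_)
open import Relation.Binary.PropositionalEquality using (_≡_)

_≡_[mod_] : ℤ → ℤ → ℕ → Set
x ≡ y [mod m ] = (+ m) ∣ (x ℤ.- y)

Odd : ℤ → Set
Odd x = ¬ ((+ 2) ∣ x)

Discriminates : ℕ → (ℕ → ℤ) → ℕ → Set
Discriminates m s n =
  ∀ i j → i ℕ.< n → j ℕ.< n → s i ≡ s j [mod m ] → i ≡ j

IsDiscriminator : (ℕ → ℤ) → ℕ → ℕ → Set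
IsDiscriminator s n d =
  (0 ℕ.< d × Discriminates d s n) ×
  (∀ m → 0 ℕ.< m → Discriminates m s n → d ℕ.≤ m)

PlusMinusOne : ℤ → ℕ → Set
PlusMinusOne t b = (t ≡ + 1 [mod 2 ℕ.^ b ]) Data.Sum.⊎ (t ≡ ℤ.- (+ 1) [mod 2 ℕ.^ b ])
  where import Data.Sum

IsLeastNonPM1 : ℤ → ℕ → Set
IsLeastNonPM1 t b =
  (0 ℕ.< b × ¬ PlusMinusOne t b) ×
  (∀ b' → 0 ℕ.< b' → ¬ PlusMinusOne t b' → b ℕ.≤ b')

-- s(n) = a ((t^2)^(n+c) - 1) / 2^b  (the division is exact under the hypotheses)
seqS : ℤ → ℤ → ℕ → ℕ → ℕ → ℤ
seqS a t c b n = (a ℤ.* ((t ℤ.* t) ℤ.^ (n ℕ.+ c) ℤ.- + 1)) /ℕ (2 ℕ.^ b)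
  where instance _ = m^n≢0 2 b

{-# OPTIONS --safe #-}
module Submission where

-- Write x = t², so that s(n) = a (x^(n+c) − 1) / 2^b.  Minimality of b forces
-- b ≥ 3 and t ≡ ±1 (mod 2^(b−1)) but t ≢ ±1 (mod 2^b), whence x = 1 + 2^b w
-- with w odd.  Lifting the exponent, x^(2^g e) − 1 is 2^(b+g) times an odd
-- number whenever e is odd; as 2^b (s(i+d) − s(i)) = a x^(i+c) (x^d − 1), the
-- power of 2 exactly dividing s(i+d) − s(i) is the one exactly dividing d.
-- Hence 2^E discriminates s(0), …, s(n−1) as soon as n ≤ 2^E.  Conversely, let
-- m = 2^f (2k+1) < 2^⌈log₂ n⌉.  Then 2^f (k+1) < n, so by pigeonhole there are
-- i < j < n with i ≡ j (mod 2^f) and t^(i+c) ≡ ±t^(j+c) (mod 2k+1).  The first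
-- congruence gives 2^f ∣ s(j) − s(i), the second gives that 2k+1 divides
-- 2^b (s(j) − s(i)) = a ((t^(j+c))² − (t^(i+c))²), so m ∣ s(j) − s(i).

open import Defs
open import Data.Nat as ℕ using (ℕ)
open import Data.Integer as ℤ using (ℤ)
open import Data.Nat.Logarithm using (⌈log₂_⌉)

module NatArithmetic where

  open import Data.Nat
  open import Data.Nat.Properties
  open import Data.Nat.DivMod using (_%_; _/_; m≡m%n+[m/n]*n; m%n<n)
  open import Data.Nat.Divisibility using (_∣_; divides)
  open import Data.Nat.Coprimality using (Coprime; coprime-divisor)
  open import Data.Nat.Primality using (prime[2]; prime⇒irreducible)
  open import Data.Nat.Induction using (<-rec)
  open import Data.Nat.Logarithm using (⌈log₂⌉-mono-≤; ⌈log₂⌈n/2⌉⌉≡⌈log₂n⌉∸1; ⌈log₂2^n⌉≡n)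
  open import Data.Fin as Fin using (Fin; toℕ; fromℕ<; combine)
  open import Data.Fin.Properties using (pigeonhole; combine-injective; fromℕ<-injective; toℕ<n)
  open import Data.Product using (∃; ∃₂; _×_; _,_)
  open import Data.Sum using (_⊎_; inj₁; inj₂)
  open import Relation.Nullary using (¬_; yes; no; contradiction)
  open import Relation.Binary.PropositionalEquality

  n+n≤2^L : ∀ {n L} → 1 ≤ L → n ≤ 2 ^ (L ∸ 1) → n + n ≤ 2 ^ L
  n+n≤2^L {n} {suc L} _ n≤2^L = begin
    n + n           ≤⟨ +-mono-≤ n≤2^L n≤2^L ⟩
    2 ^ L + 2 ^ L   ≡⟨ cong (2 ^ L +_) (+-identityʳ (2 ^ L)) ⟨
    2 ^ suc L       ∎
    where open ≤-Reasoning

  n≤2^⌈log₂n⌉ : ∀ n → n ≤ 2 ^ ⌈log₂ n ⌉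
  n≤2^⌈log₂n⌉ = <-rec _ go
    where
    go : ∀ n → (∀ {m} → m < n → m ≤ 2 ^ ⌈log₂ m ⌉) → n ≤ 2 ^ ⌈log₂ n ⌉
    go 0 _ = z≤n
    go 1 _ = s≤s z≤n
    go n@(suc (suc k)) rec = begin
      n                   ≡⟨ ⌊n/2⌋+⌈n/2⌉≡n n ⟨
      ⌊ n /2⌋ + ⌈ n /2⌉   ≤⟨ +-monoˡ-≤ ⌈ n /2⌉ (⌊n/2⌋≤⌈n/2⌉ n) ⟩
      ⌈ n /2⌉ + ⌈ n /2⌉   ≤⟨ n+n≤2^L (⌈log₂⌉-mono-≤ {2} {n} (s≤s (s≤s z≤n))) ⌈n/2⌉≤ ⟩
      2 ^ ⌈log₂ n ⌉       ∎
      where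
      open ≤-Reasoning
      ⌈n/2⌉≤ : ⌈ n /2⌉ ≤ 2 ^ (⌈log₂ n ⌉ ∸ 1)
      ⌈n/2⌉≤ = subst (λ e → ⌈ n /2⌉ ≤ 2 ^ e) (⌈log₂⌈n/2⌉⌉≡⌈log₂n⌉∸1 n) (rec (⌈n/2⌉<n k))

  ⌈log₂n⌉≡1+L⇒2^L<n : ∀ {n L} → ⌈log₂ n ⌉ ≡ suc L → 2 ^ L < n
  ⌈log₂n⌉≡1+L⇒2^L<n {n} {L} eq = ≰⇒> λ n≤2^L →
    <-irrefl refl (subst₂ _≤_ eq (⌈log₂2^n⌉≡n L) (⌈log₂⌉-mono-≤ n≤2^L))

  private
    even-or-odd : ∀ m → ∃ λ k → m ≡ 2 * k ⊎ m ≡ suc (2 * k)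
    even-or-odd zero = 0 , inj₁ refl
    even-or-odd (suc m) with even-or-odd m
    ... | k , inj₁ m≡2k   = k , inj₂ (cong suc m≡2k)
    ... | k , inj₂ m≡1+2k = suc k , inj₁ (trans (cong suc m≡1+2k) (sym (*-suc 2 k)))

  odd-part : ∀ m → 0 < m → ∃₂ λ f k → m ≡ 2 ^ f * suc (2 * k)
  odd-part = <-rec _ go
    where
    go : ∀ m → (∀ {j} → j < m → 0 < j → ∃₂ λ f k → j ≡ 2 ^ f * suc (2 * k)) →
         0 < m → ∃₂ λ f k → m ≡ 2 ^ f * suc (2 * k)
    go m rec 0<m with even-or-odd m
    ... | k , inj₂ m≡1+2k = 0 , k , trans m≡1+2k (sym (*-identityˡ _))
    ... | k , inj₁ m≡2k   = double (rec k<m 0<k)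
      where
      0<k : 0 < k
      0<k = *-cancelˡ-< 2 0 k (subst (0 <_) m≡2k 0<m)
      k<m : k < m
      k<m = subst (k <_) (trans (cong (k +_) (sym (+-identityʳ k))) (sym m≡2k)) (m<m+n k 0<k)
      double : (∃₂ λ f o → k ≡ 2 ^ f * suc (2 * o)) → ∃₂ λ f o → m ≡ 2 ^ f * suc (2 * o)
      double (f , o , k≡) =
        suc f , o , trans m≡2k (trans (cong (2 *_) k≡) (sym (*-assoc 2 (2 ^ f) _)))

  2∤1+2k : ∀ k → ¬ 2 ∣ suc (2 * k)
  2∤1+2k k (divides q 1+2k≡q*2) = even≢odd q k (trans (*-comm 2 q) (sym 1+2k≡q*2))

  2^f*[1+2k]<2^[1+L]⇒2^f*[1+k]≤2^L : ∀ f {k L} → 2 ^ f * suc (2 * k) < 2 ^ suc L →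
                                      2 ^ f * suc k ≤ 2 ^ L
  2^f*[1+2k]<2^[1+L]⇒2^f*[1+k]≤2^L zero {k} {L} lt = begin
    1 * suc k   ≡⟨ *-identityˡ (suc k) ⟩
    suc k       ≤⟨ *-cancelˡ-< 2 k (2 ^ L) (≤-<-trans (n≤1+n (2 * k)) 2k+1<2*2^L) ⟩
    2 ^ L       ∎
    where
    open ≤-Reasoning
    2k+1<2*2^L : suc (2 * k) < 2 * 2 ^ L
    2k+1<2*2^L = subst (_< 2 ^ suc L) (*-identityˡ _) lt
  2^f*[1+2k]<2^[1+L]⇒2^f*[1+k]≤2^L (suc f) {k} {zero} lt =
    contradiction (*-mono-≤ (m^n>0 2 f) (s≤s z≤n))
                  (<⇒≱ (*-cancelˡ-< 2 (2 ^ f * suc (2 * k)) 1 (subst (_< 2) (*-assoc 2 (2 ^ f) _) lt)))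
  2^f*[1+2k]<2^[1+L]⇒2^f*[1+k]≤2^L (suc f) {k} {suc L} lt = begin
    2 ^ suc f * suc k     ≡⟨ *-assoc 2 (2 ^ f) (suc k) ⟩
    2 * (2 ^ f * suc k)   ≤⟨ *-monoʳ-≤ 2 (2^f*[1+2k]<2^[1+L]⇒2^f*[1+k]≤2^L f {k} {L} lt′) ⟩
    2 ^ suc L             ∎
    where
    open ≤-Reasoning
    lt′ : 2 ^ f * suc (2 * k) < 2 ^ suc L
    lt′ = *-cancelˡ-< 2 _ _ (subst (_< 2 ^ suc (suc L)) (*-assoc 2 (2 ^ f) _) lt)

  2^g≤m<2^E⇒g<E : ∀ {g m E} → 2 ^ g ≤ m → m < 2 ^ E → g < E
  2^g≤m<2^E⇒g<E 2^g≤m m<2^E =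
    ≰⇒> λ E≤g → <-irrefl refl (≤-<-trans (≤-trans (^-monoʳ-≤ 2 E≤g) 2^g≤m) m<2^E)

  %-≡⇒∣∸ : ∀ {i j} d .{{_ : NonZero d}} → i % d ≡ j % d → d ∣ j ∸ i
  %-≡⇒∣∸ {i} {j} d i%d≡j%d = divides (j / d ∸ i / d) (begin
    j ∸ i                                       ≡⟨ cong₂ _∸_ (m≡m%n+[m/n]*n j d) (m≡m%n+[m/n]*n i d) ⟩
    (j % d + j / d * d) ∸ (i % d + i / d * d)   ≡⟨ cong (λ r → (j % d + j / d * d) ∸ (r + i / d * d)) i%d≡j%d ⟩
    (j % d + j / d * d) ∸ (j % d + i / d * d)   ≡⟨ [m+n]∸[m+o]≡n∸o (j % d) _ _ ⟩
    j / d * d ∸ i / d * d                       ≡⟨ *-distribʳ-∸ d (j / d) (i / d) ⟨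
    (j / d ∸ i / d) * d                         ∎)
    where open ≡-Reasoning

  2^f∣j∸i⇒j≡i+2^[f+g]*odd : ∀ {i j} f → i < j → 2 ^ f ∣ j ∸ i →
                             ∃₂ λ g o → j ≡ i + 2 ^ (f + g) * suc (2 * o)
  2^f∣j∸i⇒j≡i+2^[f+g]*odd f i<j (divides zero j∸i≡0) =
    contradiction (m<n⇒0<n∸m i<j) (<-irrefl (sym j∸i≡0))
  2^f∣j∸i⇒j≡i+2^[f+g]*odd {i} {j} f i<j (divides e@(suc _) j∸i≡e*2^f)
    with g , o , e≡ ← odd-part e (s≤s z≤n) = g , o , (begin
      j                         ≡⟨ m+[n∸m]≡n (<⇒≤ i<j) ⟨
      i + (j ∸ i)               ≡⟨ cong (i +_) j∸i≡e*2^f ⟩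
      i + e * 2 ^ f             ≡⟨ cong (λ e → i + e * 2 ^ f) e≡ ⟩
      i + 2 ^ g * q * 2 ^ f     ≡⟨ cong (i +_) (*-comm (2 ^ g * q) (2 ^ f)) ⟩
      i + 2 ^ f * (2 ^ g * q)   ≡⟨ cong (i +_) (*-assoc (2 ^ f) (2 ^ g) q) ⟨
      i + 2 ^ f * 2 ^ g * q     ≡⟨ cong (λ p → i + p * q) (^-distribˡ-+-* 2 f g) ⟨
      i + 2 ^ (f + g) * q       ∎)
    where
    open ≡-Reasoning
    q = suc (2 * o)

  pigeonhole₂ : ∀ {M N n} (f g : ℕ → ℕ) → (∀ i → f i < M) → (∀ i → g i < N) → M * N < n →
                ∃₂ λ i j → i < j × j < n × f i ≡ f j × g i ≡ g j
  pigeonhole₂ {M} {N} {n} f g f< g< MN<n = collide (pigeonhole MN<n class)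
    where
    f′ : Fin n → Fin M
    f′ i = fromℕ< (f< (toℕ i))
    g′ : Fin n → Fin N
    g′ i = fromℕ< (g< (toℕ i))
    class : Fin n → Fin (M * N)
    class i = combine (f′ i) (g′ i)
    collide : (∃₂ λ i j → i Fin.< j × class i ≡ class j) →
              ∃₂ λ i j → i < j × j < n × f i ≡ f j × g i ≡ g j
    collide (i , j , i<j , classᵢ≡classⱼ)
      with f′ᵢ≡f′ⱼ , g′ᵢ≡g′ⱼ ← combine-injective (f′ i) (g′ i) (f′ j) (g′ j) classᵢ≡classⱼ =
      toℕ i , toℕ j , i<j , toℕ<n j ,
      fromℕ<-injective _ _ _ _ f′ᵢ≡f′ⱼ , fromℕ<-injective _ _ _ _ g′ᵢ≡g′ⱼ

  pigeonhole-mod : ∀ {N n} d .{{_ : NonZero d}} (g : ℕ → ℕ) → (∀ i → g i < N) → d * N < n →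
                   ∃₂ λ i j → i < j × j < n × d ∣ j ∸ i × g i ≡ g j
  pigeonhole-mod d g g< dN<n
    with i , j , i<j , j<n , i%d≡j%d , gᵢ≡gⱼ ← pigeonhole₂ (_% d) g (λ i → m%n<n i d) g< dN<n =
    i , j , i<j , j<n , %-≡⇒∣∸ d i%d≡j%d , gᵢ≡gⱼ

  mirror : ℕ → ℕ → ℕ
  mirror k r with r ≤? k
  ... | yes _ = r
  ... | no  _ = suc (2 * k) ∸ r

  mirror-≤ : ∀ k r → mirror k r ≤ k
  mirror-≤ k r with r ≤? k
  ... | yes r≤k = r≤k
  ... | no  r≰k = begin
    suc (2 * k) ∸ r   ≤⟨ ∸-monoʳ-≤ (suc (2 * k)) (≰⇒> r≰k) ⟩
    2 * k ∸ k         ≡⟨ m+n∸m≡n k (k + 0) ⟩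
    k + 0             ≡⟨ +-identityʳ k ⟩
    k                 ∎
    where open ≤-Reasoning

  mirror-injective : ∀ {k r r′} → r < suc (2 * k) → r′ < suc (2 * k) → mirror k r ≡ mirror k r′ →
                     r ≡ r′ ⊎ r + r′ ≡ suc (2 * k)
  mirror-injective {k} {r} {r′} r<q r′<q eq with r ≤? k | r′ ≤? k
  ... | yes _ | yes _ = inj₁ eq
  ... | yes _ | no  _ = inj₂ (trans (cong (_+ r′) eq) (m∸n+n≡m (<⇒≤ r′<q)))
  ... | no  _ | yes _ = inj₂ (trans (cong (r +_) (sym eq)) (m+[n∸m]≡n (<⇒≤ r<q)))
  ... | no  _ | no  _ = inj₁ (∸-cancelˡ-≡ (<⇒≤ r<q) (<⇒≤ r′<q) eq)

  1+2k-coprime-2 : ∀ k → Coprime (suc (2 * k)) 2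
  1+2k-coprime-2 k (d∣1+2k , d∣2) with prime⇒irreducible prime[2] d∣2
  ... | inj₁ d≡1  = d≡1
  ... | inj₂ refl = contradiction d∣1+2k (2∤1+2k k)

  1+2k∣2^n*m⇒1+2k∣m : ∀ {k} n {m} → suc (2 * k) ∣ 2 ^ n * m → suc (2 * k) ∣ m
  1+2k∣2^n*m⇒1+2k∣m zero {m} q∣m = subst (_ ∣_) (*-identityˡ m) q∣m
  1+2k∣2^n*m⇒1+2k∣m {k} (suc n) {m} q∣2^[1+n]m = 1+2k∣2^n*m⇒1+2k∣m {k} n
    (coprime-divisor (1+2k-coprime-2 k) (subst (suc (2 * k) ∣_) (*-assoc 2 (2 ^ n) m) q∣2^[1+n]m))

open NatArithmetic

open import Data.Nat using (zero; suc; _≤_; _<_; z≤n; s≤s)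
import Data.Nat.Properties as ℕ
import Data.Nat.Divisibility as ℕ∣
open import Algebra.Properties.CommutativeSemigroup ℕ.+-commutativeSemigroup using (xy∙z≈xz∙y)
open import Data.Integer using (+_; _+_; _*_; _-_; -_; _^_; 1ℤ; 0ℤ; ∣_∣; _/ℕ_; _%ℕ_)
open import Data.Integer.Properties as ℤ
  using (abs-*; pos-*; pos-+; *-cancelˡ-≡; ^-*-assoc; ^-distribˡ-+-*; ∣i-j∣≡∣j-i∣; i-j≡0⇒i≡j;
         ∣i∣≡0⇒i≡0)
open import Data.Integer.DivMod using (a≡a%ℕn+[a/ℕn]*n; n%ℕd<d)
open import Data.Integer.Divisibility using (_∣_)
open import Data.Integer.Divisibility.Signed as Signed using (divides; ∣ᵤ⇒∣; ∣⇒∣ᵤ)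
open import Data.Integer.Tactic.RingSolver using (solve-∀)
open import Data.Nat.Primality using (prime[2]; euclidsLemma)
open import Data.Product using (∃; _×_; _,_)
open import Data.Sum as Sum using (_⊎_; inj₁; inj₂; [_,_]′)
open import Relation.Nullary using (¬_; Dec; contradiction)
open import Relation.Nullary.Decidable using (_⊎-dec_; decidable-stable)
open import Relation.Binary.Definitions using (tri<; tri≈; tri>)
open import Function using (_∘_)
open import Relation.Binary.PropositionalEquality

odd-1 : Odd 1ℤ
odd-1 2∣1 = contradiction (ℕ∣.∣1⇒≡1 2∣1) λ ()

odd-* : ∀ u v → Odd u → Odd v → Odd (u * v)
odd-* u v odd-u odd-v 2∣uv =
  [ odd-u , odd-v ]′ (euclidsLemma ∣ u ∣ ∣ v ∣ prime[2] (subst (2 ℕ∣.∣_) (abs-* u v) 2∣uv))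

odd-^ : ∀ u → Odd u → ∀ n → Odd (u ^ n)
odd-^ u odd-u zero    = odd-1
odd-^ u odd-u (suc n) = odd-* u (u ^ n) odd-u (odd-^ u odd-u n)

odd-+-even : ∀ u w → Odd u → Odd (u + + 2 * w)
odd-+-even u w odd-u 2∣u+2w = odd-u (∣⇒∣ᵤ {+ 2} {u}
  (Signed.∣m+n∣n⇒∣m (∣ᵤ⇒∣ {+ 2} {u + + 2 * w} 2∣u+2w) (Signed.∣m⇒∣m*n w (Signed.∣-refl {+ 2}))))

ε²≡1⇒odd : ∀ ε → ε * ε ≡ 1ℤ → Odd ε
ε²≡1⇒odd ε ε²≡1 2∣ε =
  odd-1 (subst (2 ℕ∣.∣_) (trans (sym (abs-* ε ε)) (cong ∣_∣ ε²≡1)) (ℕ∣.∣m⇒∣m*n ∣ ε ∣ 2∣ε))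

even-or-odd : ∀ z → ∃ λ h → z ≡ + 2 * h ⊎ z ≡ 1ℤ + + 2 * h
even-or-odd z with z %ℕ 2 | n%ℕd<d z 2 | a≡a%ℕn+[a/ℕn]*n z 2
... | 0 | _ | z≡ = z /ℕ 2 , inj₁ (trans z≡ (reorder (z /ℕ 2)))
  where
  reorder : ∀ h → + 0 + h * + 2 ≡ + 2 * h
  reorder = solve-∀
... | 1 | _ | z≡ = z /ℕ 2 , inj₂ (trans z≡ (reorder (z /ℕ 2)))
  where
  reorder : ∀ h → 1ℤ + h * + 2 ≡ 1ℤ + + 2 * h
  reorder = solve-∀
... | suc (suc _) | s≤s (s≤s ()) | _

record 2^_∥_ (k : ℕ) (z : ℤ) : Set where
  constructor exact
  field
    odd-factor     : ℤ
    odd-factor-odd : Odd odd-factor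
    split          : z ≡ + (2 ℕ.^ k) * odd-factor

pos-^-distribˡ-+-* : ∀ p m k → + (p ℕ.^ (m ℕ.+ k)) ≡ + (p ℕ.^ m) * + (p ℕ.^ k)
pos-^-distribˡ-+-* p m k = trans (cong +_ (ℕ.^-distribˡ-+-* p m k)) (pos-* (p ℕ.^ m) (p ℕ.^ k))

∣∧∤⇒∥ : ∀ {k z} → + (2 ℕ.^ k) ∣ z → ¬ (+ (2 ℕ.^ suc k) ∣ z) → 2^ k ∥ z
∣∧∤⇒∥ {k} {z} 2^k∣z 2^[1+k]∤z = exact K odd-K (trans z≡K*2^k (ℤ.*-comm K _))
  where
  open Signed._∣_ (∣ᵤ⇒∣ {+ (2 ℕ.^ k)} {z} 2^k∣z) renaming (quotient to K; equality to z≡K*2^k)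
  ∣z∣≡∣K∣*2^k : ∣ z ∣ ≡ ∣ K ∣ ℕ.* 2 ℕ.^ k
  ∣z∣≡∣K∣*2^k = trans (cong ∣_∣ z≡K*2^k) (abs-* K _)
  odd-K : Odd K
  odd-K 2∣K = 2^[1+k]∤z (subst (2 ℕ.^ suc k ℕ∣.∣_) (sym ∣z∣≡∣K∣*2^k) (ℕ∣.*-monoˡ-∣ (2 ℕ.^ k) 2∣K))

∥⇒∣ : ∀ {k z} → 2^ k ∥ z → + (2 ℕ.^ k) Signed.∣ z
∥⇒∣ (exact u _ z≡2^k*u) = divides u (trans z≡2^k*u (ℤ.*-comm _ u))

∥⇒∤ : ∀ {g E z} → g < E → 2^ g ∥ z → ¬ (+ (2 ℕ.^ E) ∣ z)
∥⇒∤ {g} {E} {z} g<E (exact u odd-u z≡2^g*u) 2^E∣z with o , refl ← ℕ.m≤n⇒∃[o]m+o≡n g<E =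
  odd-u (ℕ∣.*-cancelʳ-∣ (2 ℕ.^ g) {{ℕ.m^n≢0 2 g}}
          (subst (2 ℕ.^ suc g ℕ∣.∣_) ∣z∣≡∣u∣*2^g 2^[1+g]∣z))
  where
  2^[1+g]∣z : 2 ℕ.^ suc g ℕ∣.∣ ∣ z ∣
  2^[1+g]∣z = ℕ∣.m*n∣⇒m∣ (2 ℕ.^ suc g) (2 ℕ.^ o)
                (subst (ℕ∣._∣ ∣ z ∣) (ℕ.^-distribˡ-+-* 2 (suc g) o) 2^E∣z)
  ∣z∣≡∣u∣*2^g : ∣ z ∣ ≡ ∣ u ∣ ℕ.* 2 ℕ.^ g
  ∣z∣≡∣u∣*2^g = trans (cong ∣_∣ z≡2^g*u) (trans (abs-* (+ (2 ℕ.^ g)) u) (ℕ.*-comm (2 ℕ.^ g) ∣ u ∣))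

∥∧odd∣⇒∣ : ∀ {b f g k z} → 2^ (f ℕ.+ g) ∥ z → + suc (2 ℕ.* k) ∣ + (2 ℕ.^ b) * z →
           + (2 ℕ.^ f ℕ.* suc (2 ℕ.* k)) ∣ z
∥∧odd∣⇒∣ {b} {f} {g} {k} (exact u _ refl) q∣2^b*z =
  subst (_ ℕ∣.∣_) (sym ∣z∣≡) (ℕ∣.*-monoʳ-∣ (2 ℕ.^ f) (ℕ∣.∣n⇒∣m*n (2 ℕ.^ g) q∣u))
  where
  open ≡-Reasoning
  ∣z∣≡ : ∣ + (2 ℕ.^ (f ℕ.+ g)) * u ∣ ≡ 2 ℕ.^ f ℕ.* (2 ℕ.^ g ℕ.* ∣ u ∣)
  ∣z∣≡ = begin
    ∣ + (2 ℕ.^ (f ℕ.+ g)) * u ∣       ≡⟨ abs-* (+ (2 ℕ.^ (f ℕ.+ g))) u ⟩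
    2 ℕ.^ (f ℕ.+ g) ℕ.* ∣ u ∣         ≡⟨ cong (ℕ._* ∣ u ∣) (ℕ.^-distribˡ-+-* 2 f g) ⟩
    2 ℕ.^ f ℕ.* 2 ℕ.^ g ℕ.* ∣ u ∣     ≡⟨ ℕ.*-assoc (2 ℕ.^ f) (2 ℕ.^ g) ∣ u ∣ ⟩
    2 ℕ.^ f ℕ.* (2 ℕ.^ g ℕ.* ∣ u ∣)   ∎
  ∣2^b*z∣≡ : ∣ + (2 ℕ.^ b) * (+ (2 ℕ.^ (f ℕ.+ g)) * u) ∣ ≡ 2 ℕ.^ (b ℕ.+ (f ℕ.+ g)) ℕ.* ∣ u ∣
  ∣2^b*z∣≡ = begin
    ∣ + (2 ℕ.^ b) * (+ (2 ℕ.^ (f ℕ.+ g)) * u) ∣   ≡⟨ abs-* (+ (2 ℕ.^ b)) _ ⟩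
    2 ℕ.^ b ℕ.* ∣ + (2 ℕ.^ (f ℕ.+ g)) * u ∣       ≡⟨ cong (2 ℕ.^ b ℕ.*_) (abs-* (+ (2 ℕ.^ (f ℕ.+ g))) u) ⟩
    2 ℕ.^ b ℕ.* (2 ℕ.^ (f ℕ.+ g) ℕ.* ∣ u ∣)       ≡⟨ ℕ.*-assoc (2 ℕ.^ b) _ _ ⟨
    2 ℕ.^ b ℕ.* 2 ℕ.^ (f ℕ.+ g) ℕ.* ∣ u ∣         ≡⟨ cong (ℕ._* ∣ u ∣) (ℕ.^-distribˡ-+-* 2 b (f ℕ.+ g)) ⟨
    2 ℕ.^ (b ℕ.+ (f ℕ.+ g)) ℕ.* ∣ u ∣             ∎
  q∣u : suc (2 ℕ.* k) ℕ∣.∣ ∣ u ∣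
  q∣u = 1+2k∣2^n*m⇒1+2k∣m {k} (b ℕ.+ (f ℕ.+ g)) (subst (suc (2 ℕ.* k) ℕ∣.∣_) ∣2^b*z∣≡ q∣2^b*z)

x^n-1≡[x-1]*[n+[x-1]*K] : ∀ x n → ∃ λ K → x ^ n - 1ℤ ≡ (x - 1ℤ) * (+ n + (x - 1ℤ) * K)
x^n-1≡[x-1]*[n+[x-1]*K] x zero = 0ℤ , base x
  where
  base : ∀ x → 1ℤ - 1ℤ ≡ (x - 1ℤ) * (+ 0 + (x - 1ℤ) * 0ℤ)
  base = solve-∀
x^n-1≡[x-1]*[n+[x-1]*K] x (suc n) with K , x^n-1≡ ← x^n-1≡[x-1]*[n+[x-1]*K] x n =
  K + (+ n + (x - 1ℤ) * K) , (begin
    x * x ^ n - 1ℤ                                      ≡⟨ split x (x ^ n) ⟩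
    x * (x ^ n - 1ℤ) + (x - 1ℤ)                         ≡⟨ cong (λ y → x * y + (x - 1ℤ)) x^n-1≡ ⟩
    x * ((x - 1ℤ) * (+ n + (x - 1ℤ) * K)) + (x - 1ℤ)    ≡⟨ regroup x (+ n) K ⟩
    (x - 1ℤ) * (1ℤ + + n + (x - 1ℤ) * (K + (+ n + (x - 1ℤ) * K))) ∎)
  where
  open ≡-Reasoning
  split : ∀ x X → x * X - 1ℤ ≡ x * (X - 1ℤ) + (x - 1ℤ)
  split = solve-∀
  regroup : ∀ x N K → x * ((x - 1ℤ) * (N + (x - 1ℤ) * K)) + (x - 1ℤ) ≡
                      (x - 1ℤ) * (1ℤ + N + (x - 1ℤ) * (K + (N + (x - 1ℤ) * K)))
  regroup = solve-∀

x-1∣x^n-1 : ∀ x n → (x - 1ℤ) Signed.∣ (x ^ n - 1ℤ)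
x-1∣x^n-1 x n with K , x^n-1≡ ← x^n-1≡[x-1]*[n+[x-1]*K] x n =
  divides (+ n + (x - 1ℤ) * K) (trans x^n-1≡ (ℤ.*-comm (x - 1ℤ) _))

∥-pow-odd : ∀ {k x} e → 2^ suc k ∥ (x - 1ℤ) → Odd (+ e) → 2^ suc k ∥ (x ^ e - 1ℤ)
∥-pow-odd {k} {x} e (exact u odd-u x-1≡) odd-e with K , x^e-1≡ ← x^n-1≡[x-1]*[n+[x-1]*K] x e =
  exact w (odd-* u _ odd-u (odd-+-even (+ e) (P * u * K) odd-e)) (begin
    x ^ e - 1ℤ                                              ≡⟨ x^e-1≡ ⟩
    (x - 1ℤ) * (+ e + (x - 1ℤ) * K)                         ≡⟨ cong (λ y → y * (+ e + y * K)) x-1≡ ⟩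
    + (2 ℕ.^ suc k) * u * (+ e + + (2 ℕ.^ suc k) * u * K)   ≡⟨ cong (λ p → p * u * (+ e + p * u * K)) 2^[1+k]≡ ⟩
    + 2 * P * u * (+ e + + 2 * P * u * K)                   ≡⟨ regroup (+ e) P u K ⟩
    + 2 * P * w                                             ≡⟨ cong (_* w) 2^[1+k]≡ ⟨
    + (2 ℕ.^ suc k) * w                                     ∎)
  where
  open ≡-Reasoning
  P = + (2 ℕ.^ k)
  w = u * (+ e + + 2 * (P * u * K))
  2^[1+k]≡ : + (2 ℕ.^ suc k) ≡ + 2 * P
  2^[1+k]≡ = pos-^-distribˡ-+-* 2 1 k
  regroup : ∀ e P u K → + 2 * P * u * (e + + 2 * P * u * K) ≡ + 2 * P * (u * (e + + 2 * (P * u * K)))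
  regroup = solve-∀

∥-square : ∀ {k x} ε → ε * ε ≡ 1ℤ → 2^ suc (suc k) ∥ (x - ε) → 2^ suc (suc (suc k)) ∥ (x * x - 1ℤ)
∥-square {k} {x} ε ε²≡1 (exact u odd-u x-ε≡) =
  exact w (odd-* u _ odd-u (odd-+-even ε (P * u) (ε²≡1⇒odd ε ε²≡1))) (begin
    x * x - 1ℤ                                                  ≡⟨ cong (λ e → x * x - e) ε²≡1 ⟨
    x * x - ε * ε                                               ≡⟨ factor x ε ⟩
    (x - ε) * ((x - ε) + + 2 * ε)                               ≡⟨ cong (λ y → y * (y + + 2 * ε)) x-ε≡ ⟩
    + (2 ℕ.^ (2 ℕ.+ k)) * u * (+ (2 ℕ.^ (2 ℕ.+ k)) * u + + 2 * ε)
      ≡⟨ cong (λ p → p * u * (p * u + + 2 * ε)) (pos-^-distribˡ-+-* 2 2 k) ⟩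
    + 4 * P * u * (+ 4 * P * u + + 2 * ε)                       ≡⟨ regroup ε P u ⟩
    + 8 * P * w                                                 ≡⟨ cong (_* w) (pos-^-distribˡ-+-* 2 3 k) ⟨
    + (2 ℕ.^ (3 ℕ.+ k)) * w                                     ∎)
  where
  open ≡-Reasoning
  P = + (2 ℕ.^ k)
  w = u * (ε + + 2 * (P * u))
  factor : ∀ x ε → x * x - ε * ε ≡ (x - ε) * ((x - ε) + + 2 * ε)
  factor = solve-∀
  regroup : ∀ ε P u → + 4 * P * u * (+ 4 * P * u + + 2 * ε) ≡ + 8 * P * (u * (ε + + 2 * (P * u)))
  regroup = solve-∀

∥-pow-2^ : ∀ {k x} → 2 ≤ k → 2^ k ∥ (x - 1ℤ) → ∀ g → 2^ (k ℕ.+ g) ∥ (x ^ (2 ℕ.^ g) - 1ℤ)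
∥-pow-2^ {k} {x} _ x-1∥ zero =
  subst₂ 2^_∥_ (sym (ℕ.+-identityʳ k)) (cong (_- 1ℤ) (sym (ℤ.^-identityʳ x))) x-1∥
∥-pow-2^ {suc (suc k)} {x} (s≤s (s≤s _)) x-1∥ (suc g) =
  subst₂ 2^_∥_ (sym (ℕ.+-suc (suc (suc k)) g)) (cong (_- 1ℤ) [x*x]^2^g≡x^2^[1+g])
         (∥-pow-2^ {suc (suc (suc k))} {x * x} (s≤s (s≤s z≤n)) (∥-square {k} {x} 1ℤ refl x-1∥) g)
  where
  [x*x]^2^g≡x^2^[1+g] : (x * x) ^ (2 ℕ.^ g) ≡ x ^ (2 ℕ.^ suc g)
  [x*x]^2^g≡x^2^[1+g] =
    trans (cong (λ y → (x * y) ^ (2 ℕ.^ g)) (sym (ℤ.*-identityʳ x))) (^-*-assoc x 2 (2 ℕ.^ g))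

∥-pow : ∀ {k x} → 2 ≤ k → 2^ k ∥ (x - 1ℤ) → ∀ g o →
        2^ (k ℕ.+ g) ∥ (x ^ (2 ℕ.^ g ℕ.* suc (2 ℕ.* o)) - 1ℤ)
∥-pow {suc (suc k)} {x} 2≤k@(s≤s (s≤s _)) x-1∥ g o =
  subst (λ y → 2^ (suc (suc k) ℕ.+ g) ∥ (y - 1ℤ)) (^-*-assoc x (2 ℕ.^ g) (suc (2 ℕ.* o)))
        (∥-pow-odd {suc (k ℕ.+ g)} {x ^ (2 ℕ.^ g)} (suc (2 ℕ.* o)) (∥-pow-2^ 2≤k x-1∥ g) (2∤1+2k o))

PlusMinusOne? : ∀ t b → Dec (PlusMinusOne t b)
PlusMinusOne? t b = (2 ℕ.^ b ℕ∣.∣? ∣ t - + 1 ∣) ⊎-dec (2 ℕ.^ b ℕ∣.∣? ∣ t - - + 1 ∣)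

odd⇒PlusMinusOne₂ : ∀ t → Odd t → PlusMinusOne t 2
odd⇒PlusMinusOne₂ t odd-t with even-or-odd t
... | h , inj₁ t≡2h = contradiction (∣⇒∣ᵤ {+ 2} {t} (divides h (trans t≡2h (ℤ.*-comm (+ 2) h)))) odd-t
... | h , inj₂ t≡1+2h with even-or-odd h
...   | h′ , inj₁ h≡2h′ = inj₁ (∣⇒∣ᵤ {+ 4} {t - 1ℤ} (divides h′ (begin
  t - 1ℤ                        ≡⟨ cong (_- 1ℤ) (trans t≡1+2h (cong (λ h → 1ℤ + + 2 * h) h≡2h′)) ⟩
  1ℤ + + 2 * (+ 2 * h′) - 1ℤ    ≡⟨ rearrange h′ ⟩
  h′ * + 4                      ∎)))
  where
  open ≡-Reasoning
  rearrange : ∀ h′ → 1ℤ + + 2 * (+ 2 * h′) - 1ℤ ≡ h′ * + 4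
  rearrange = solve-∀
...   | h′ , inj₂ h≡1+2h′ = inj₂ (∣⇒∣ᵤ {+ 4} {t - - 1ℤ} (divides (1ℤ + h′) (begin
  t - - 1ℤ                              ≡⟨ cong (_- - 1ℤ) (trans t≡1+2h (cong (λ h → 1ℤ + + 2 * h) h≡1+2h′)) ⟩
  1ℤ + + 2 * (1ℤ + + 2 * h′) - - 1ℤ     ≡⟨ rearrange h′ ⟩
  (1ℤ + h′) * + 4                       ∎)))
  where
  open ≡-Reasoning
  rearrange : ∀ h′ → 1ℤ + + 2 * (1ℤ + + 2 * h′) - - 1ℤ ≡ (1ℤ + h′) * + 4
  rearrange = solve-∀

PlusMinusOne₂⇒PlusMinusOne₁ : ∀ t → PlusMinusOne t 2 → PlusMinusOne t 1
PlusMinusOne₂⇒PlusMinusOne₁ _ = Sum.map (ℕ∣.∣-trans 2∣4) (ℕ∣.∣-trans 2∣4)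
  where
  2∣4 : 2 ℕ∣.∣ 4
  2∣4 = ℕ∣.divides 2 refl

PlusMinusOne-boundary⇒∥ : ∀ {t k} → PlusMinusOne t (suc (suc k)) → ¬ PlusMinusOne t (suc (suc (suc k))) →
                          2^ suc (suc (suc k)) ∥ (t * t - 1ℤ)
PlusMinusOne-boundary⇒∥ {t} {k} (inj₁ pm) ¬pm =
  ∥-square {k} {t} 1ℤ refl (∣∧∤⇒∥ {suc (suc k)} {t - 1ℤ} pm (¬pm ∘ inj₁))
PlusMinusOne-boundary⇒∥ {t} {k} (inj₂ pm) ¬pm =
  ∥-square {k} {t} (- 1ℤ) refl (∣∧∤⇒∥ {suc (suc k)} {t - - 1ℤ} pm (¬pm ∘ inj₂))

IsLeastNonPM1⇒∥ : ∀ {t b} → Odd t → IsLeastNonPM1 t b → 2 ≤ b × 2^ b ∥ (t * t - 1ℤ)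
IsLeastNonPM1⇒∥ {b = 0} _ ((() , _) , _)
IsLeastNonPM1⇒∥ {t} {1} odd-t ((_ , ¬pm) , _) =
  contradiction (PlusMinusOne₂⇒PlusMinusOne₁ t (odd⇒PlusMinusOne₂ t odd-t)) ¬pm
IsLeastNonPM1⇒∥ {t} {2} odd-t ((_ , ¬pm) , _) = contradiction (odd⇒PlusMinusOne₂ t odd-t) ¬pm
IsLeastNonPM1⇒∥ {t} {suc (suc (suc k))} odd-t ((_ , ¬pm) , least) =
  s≤s (s≤s z≤n) , PlusMinusOne-boundary⇒∥ {t} {k} pm ¬pm
  where
  pm : PlusMinusOne t (suc (suc k))
  pm = decidable-stable (PlusMinusOne? t (suc (suc k)))
         λ ¬pm′ → ℕ.<-irrefl refl (least (suc (suc k)) (s≤s z≤n) ¬pm′)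

[q*d]/ℕd≡q : ∀ d .{{_ : ℕ.NonZero d}} q → (q * + d) /ℕ d ≡ q
[q*d]/ℕd≡q d q = sym (i-j≡0⇒i≡j q Q (∣i∣≡0⇒i≡0 ∣q-Q∣≡0))
  where
  open ≡-Reasoning
  Q = (q * + d) /ℕ d
  r = (q * + d) %ℕ d
  r≡∣q-Q∣*d : r ≡ ∣ q - Q ∣ ℕ.* d
  r≡∣q-Q∣*d = trans (cong ∣_∣ (begin
    + r                       ≡⟨ add-sub (+ r) (Q * + d) ⟩
    + r + Q * + d - Q * + d   ≡⟨ cong (_- Q * + d) (a≡a%ℕn+[a/ℕn]*n (q * + d) d) ⟨
    q * + d - Q * + d         ≡⟨ factor q Q (+ d) ⟩
    (q - Q) * + d             ∎)) (abs-* (q - Q) (+ d))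
    where
    add-sub : ∀ r y → r ≡ r + y - y
    add-sub = solve-∀
    factor : ∀ q Q d → q * d - Q * d ≡ (q - Q) * d
    factor = solve-∀
  ∣q-Q∣≡0 : ∣ q - Q ∣ ≡ 0
  ∣q-Q∣≡0 = ℕ.n<1⇒n≡0 (ℕ.*-cancelʳ-< d ∣ q - Q ∣ 1
    (subst₂ ℕ._<_ r≡∣q-Q∣*d (sym (ℕ.*-identityˡ d)) (n%ℕd<d (q * + d) d)))

d∣z⇒d*[z/ℕd]≡z : ∀ d .{{_ : ℕ.NonZero d}} z → + d Signed.∣ z → + d * (z /ℕ d) ≡ z
d∣z⇒d*[z/ℕd]≡z d _ (divides q refl) = trans (cong (+ d *_) ([q*d]/ℕd≡q d q)) (ℤ.*-comm (+ d) q)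

^-distrib-* : ∀ u v n → (u * v) ^ n ≡ u ^ n * v ^ n
^-distrib-* u v zero    = refl
^-distrib-* u v (suc n) = trans (cong (u * v *_) (^-distrib-* u v n)) (interchange u v (u ^ n) (v ^ n))
  where
  interchange : ∀ u v U V → u * v * (U * V) ≡ u * U * (v * V)
  interchange = solve-∀

%ℕ-≡⇒∣- : ∀ τ τ′ d .{{_ : ℕ.NonZero d}} → τ %ℕ d ≡ τ′ %ℕ d → + d Signed.∣ (τ′ - τ)
%ℕ-≡⇒∣- τ τ′ d r≡r′ = divides (Q′ - Q) (begin
  τ′ - τ                                ≡⟨ cong₂ _-_ (a≡a%ℕn+[a/ℕn]*n τ′ d) (a≡a%ℕn+[a/ℕn]*n τ d) ⟩
  + r′ + Q′ * + d - (+ r + Q * + d)     ≡⟨ cong (λ r → + r′ + Q′ * + d - (+ r + Q * + d)) r≡r′ ⟩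
  + r′ + Q′ * + d - (+ r′ + Q * + d)    ≡⟨ cancel (+ r′) Q′ Q (+ d) ⟩
  (Q′ - Q) * + d                        ∎)
  where
  open ≡-Reasoning
  r = τ %ℕ d
  r′ = τ′ %ℕ d
  Q = τ /ℕ d
  Q′ = τ′ /ℕ d
  cancel : ∀ r Q′ Q d → r + Q′ * d - (r + Q * d) ≡ (Q′ - Q) * d
  cancel = solve-∀

%ℕ-+≡⇒∣+ : ∀ τ τ′ d .{{_ : ℕ.NonZero d}} → τ %ℕ d ℕ.+ τ′ %ℕ d ≡ d → + d Signed.∣ (τ′ + τ)
%ℕ-+≡⇒∣+ τ τ′ d r+r′≡d = divides (1ℤ + Q + Q′) (begin
  τ′ + τ                                ≡⟨ cong₂ _+_ (a≡a%ℕn+[a/ℕn]*n τ′ d) (a≡a%ℕn+[a/ℕn]*n τ d) ⟩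
  + r′ + Q′ * + d + (+ r + Q * + d)     ≡⟨ regroup (+ r) (+ r′) Q Q′ (+ d) ⟩
  (+ r + + r′) + (Q + Q′) * + d         ≡⟨ cong (λ y → y + (Q + Q′) * + d) r+r′≡d′ ⟩
  + d + (Q + Q′) * + d                  ≡⟨ factor Q Q′ (+ d) ⟩
  (1ℤ + Q + Q′) * + d                   ∎)
  where
  open ≡-Reasoning
  r = τ %ℕ d
  r′ = τ′ %ℕ d
  Q = τ /ℕ d
  Q′ = τ′ /ℕ d
  r+r′≡d′ : + r + + r′ ≡ + d
  r+r′≡d′ = trans (sym (pos-+ r r′)) (cong +_ r+r′≡d)
  regroup : ∀ r r′ Q Q′ d → r′ + Q′ * d + (r + Q * d) ≡ (r + r′) + (Q + Q′) * d
  regroup = solve-∀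
  factor : ∀ Q Q′ d → d + (Q + Q′) * d ≡ (1ℤ + Q + Q′) * d
  factor = solve-∀

mirror-≡⇒∣ : ∀ k τ τ′ → mirror k (τ %ℕ suc (2 ℕ.* k)) ≡ mirror k (τ′ %ℕ suc (2 ℕ.* k)) →
             + suc (2 ℕ.* k) Signed.∣ (τ′ * τ′ - τ * τ)
mirror-≡⇒∣ k τ τ′ same = subst (+ q Signed.∣_) (sym (difference-of-squares τ τ′))
  ([ (λ r≡r′ → Signed.∣m⇒∣m*n (τ′ + τ) (%ℕ-≡⇒∣- τ τ′ q r≡r′))
   , (λ r+r′≡q → Signed.∣n⇒∣m*n (τ′ - τ) (%ℕ-+≡⇒∣+ τ τ′ q r+r′≡q)) ]′
   (mirror-injective {k} (n%ℕd<d τ q) (n%ℕd<d τ′ q) same))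
  where
  q = suc (2 ℕ.* k)
  difference-of-squares : ∀ τ τ′ → τ′ * τ′ - τ * τ ≡ (τ′ - τ) * (τ′ + τ)
  difference-of-squares = solve-∀

≡[mod]-sym : ∀ {x y m} → x ≡ y [mod m ] → y ≡ x [mod m ]
≡[mod]-sym {x} {y} = subst (_ ℕ∣.∣_) (∣i-j∣≡∣j-i∣ x y)

incongruent⇒discriminates : ∀ {m s n} → (∀ {i j} → i < j → j < n → ¬ (s j ≡ s i [mod m ])) →
                            Discriminates m s n
incongruent⇒discriminates {s = s} incongruent i j i<n j<n sᵢ≡sⱼ with ℕ.<-cmp i j
... | tri< i<j _ _ = contradiction (≡[mod]-sym {s i} {s j} sᵢ≡sⱼ) (incongruent i<j j<n)
... | tri≈ _ i≡j _ = i≡j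
... | tri> _ _ j<i = contradiction sᵢ≡sⱼ (incongruent j<i i<n)

congruent⇒¬discriminates : ∀ {m s n i j} → i < j → j < n → s j ≡ s i [mod m ] → ¬ Discriminates m s n
congruent⇒¬discriminates {s = s} {i = i} {j} i<j j<n sⱼ≡sᵢ discriminates =
  ℕ.<-irrefl (discriminates i j (ℕ.<-trans i<j j<n) j<n (≡[mod]-sym {s j} {s i} sⱼ≡sᵢ)) i<j

module Sequence (a t : ℤ) (c b : ℕ) (odd-a : Odd a) (odd-t : Odd t)
                (2≤b : 2 ≤ b) (t²-1∥ : 2^ b ∥ (t * t - 1ℤ)) where

  instance
    2^b≢0 : ℕ.NonZero (2 ℕ.^ b)
    2^b≢0 = ℕ.m^n≢0 2 b

  x : ℤ
  x = t * t

  s : ℕ → ℤ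
  s = seqS a t c b

  scaled-s : ∀ n → + (2 ℕ.^ b) * s n ≡ a * (x ^ (n ℕ.+ c) - 1ℤ)
  scaled-s n = d∣z⇒d*[z/ℕd]≡z (2 ℕ.^ b) _
    (Signed.∣n⇒∣m*n a (Signed.∣-trans (∥⇒∣ t²-1∥) (x-1∣x^n-1 x (n ℕ.+ c))))

  scaled-s-difference : ∀ i j → + (2 ℕ.^ b) * (s j - s i) ≡ a * (x ^ (j ℕ.+ c) - x ^ (i ℕ.+ c))
  scaled-s-difference i j = begin
    B * (s j - s i)                                       ≡⟨ distrib B (s j) (s i) ⟩
    B * s j - B * s i                                     ≡⟨ cong₂ _-_ (scaled-s j) (scaled-s i) ⟩
    a * (x ^ (j ℕ.+ c) - 1ℤ) - a * (x ^ (i ℕ.+ c) - 1ℤ)   ≡⟨ cancel a (x ^ (j ℕ.+ c)) (x ^ (i ℕ.+ c)) ⟩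
    a * (x ^ (j ℕ.+ c) - x ^ (i ℕ.+ c))                   ∎
    where
    open ≡-Reasoning
    B = + (2 ℕ.^ b)
    distrib : ∀ B u v → B * (u - v) ≡ B * u - B * v
    distrib = solve-∀
    cancel : ∀ a X Y → a * (X - 1ℤ) - a * (Y - 1ℤ) ≡ a * (X - Y)
    cancel = solve-∀

  s-step-valuation : ∀ i g o → 2^ g ∥ (s (i ℕ.+ 2 ℕ.^ g ℕ.* suc (2 ℕ.* o)) - s i)
  s-step-valuation i g o with exact u odd-u x^d-1≡ ← ∥-pow 2≤b t²-1∥ g o =
    exact (a * X * u) (odd-* (a * X) u (odd-* a X odd-a odd-X) odd-u) (*-cancelˡ-≡ B _ _ (begin
      B * (s (i ℕ.+ d) - s i)             ≡⟨ scaled-s-difference i (i ℕ.+ d) ⟩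
      a * (x ^ (i ℕ.+ d ℕ.+ c) - X)       ≡⟨ cong (λ y → a * (y - X)) x^[i+d+c]≡X*x^d ⟩
      a * (X * x ^ d - X)                 ≡⟨ factor a X (x ^ d) ⟩
      a * X * (x ^ d - 1ℤ)                ≡⟨ cong (a * X *_) x^d-1≡ ⟩
      a * X * (+ (2 ℕ.^ (b ℕ.+ g)) * u)   ≡⟨ cong (λ p → a * X * (p * u)) (pos-^-distribˡ-+-* 2 b g) ⟩
      a * X * (B * + (2 ℕ.^ g) * u)       ≡⟨ regroup a X B (+ (2 ℕ.^ g)) u ⟩
      B * (+ (2 ℕ.^ g) * (a * X * u))     ∎))
    where
    open ≡-Reasoning
    B = + (2 ℕ.^ b)
    d = 2 ℕ.^ g ℕ.* suc (2 ℕ.* o)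
    X = x ^ (i ℕ.+ c)
    odd-X : Odd X
    odd-X = odd-^ x (odd-* t t odd-t odd-t) (i ℕ.+ c)
    x^[i+d+c]≡X*x^d : x ^ (i ℕ.+ d ℕ.+ c) ≡ X * x ^ d
    x^[i+d+c]≡X*x^d = trans (cong (x ^_) (xy∙z≈xz∙y i d c)) (^-distribˡ-+-* x (i ℕ.+ c) d)
    factor : ∀ a X D → a * (X * D - X) ≡ a * X * (D - 1ℤ)
    factor = solve-∀
    regroup : ∀ a X B G u → a * X * (B * G * u) ≡ B * (G * (a * X * u))
    regroup = solve-∀

  s-incongruent : ∀ {E i j} → i < j → j < 2 ℕ.^ E → ¬ (s j ≡ s i [mod 2 ℕ.^ E ])
  s-incongruent {E} {i} i<j j<2^E with g , o , refl ← 2^f∣j∸i⇒j≡i+2^[f+g]*odd 0 i<j (ℕ∣.1∣ _) =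
    ∥⇒∤ {g} {E} (2^g≤m<2^E⇒g<E 2^g≤j j<2^E) (s-step-valuation i g o)
    where
    2^g≤j : 2 ℕ.^ g ≤ i ℕ.+ 2 ℕ.^ g ℕ.* suc (2 ℕ.* o)
    2^g≤j = ℕ.≤-trans (ℕ.m≤m*n (2 ℕ.^ g) (suc (2 ℕ.* o))) (ℕ.m≤n+m _ i)

  2^E-discriminates : ∀ {E n} → n ≤ 2 ℕ.^ E → Discriminates (2 ℕ.^ E) s n
  2^E-discriminates {E} n≤2^E =
    incongruent⇒discriminates {s = s} λ i<j j<n → s-incongruent {E} i<j (ℕ.<-≤-trans j<n n≤2^E)

  τ : ℕ → ℤ
  τ n = t ^ (n ℕ.+ c)

  unsigned-residue : ℕ → ℕ → ℕ
  unsigned-residue k n = mirror k (τ n %ℕ suc (2 ℕ.* k))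

  unsigned-residue-< : ∀ k n → unsigned-residue k n < suc k
  unsigned-residue-< k n = s≤s (mirror-≤ k (τ n %ℕ suc (2 ℕ.* k)))

  s-congruent : ∀ {f k i j} → i < j → 2 ℕ.^ f ℕ∣.∣ j ℕ.∸ i →
                unsigned-residue k i ≡ unsigned-residue k j →
                s j ≡ s i [mod 2 ℕ.^ f ℕ.* suc (2 ℕ.* k) ]
  s-congruent {f} {k} {i} i<j 2^f∣j∸i same-residue
    with g , o , refl ← 2^f∣j∸i⇒j≡i+2^[f+g]*odd f i<j 2^f∣j∸i =
    ∥∧odd∣⇒∣ {b} {f} {g} {k} (s-step-valuation i (f ℕ.+ g) o)
             (∣⇒∣ᵤ {+ suc (2 ℕ.* k)} {+ (2 ℕ.^ b) * (s j - s i)} q∣2^b*[sⱼ-sᵢ])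
    where
    j = i ℕ.+ 2 ℕ.^ (f ℕ.+ g) ℕ.* suc (2 ℕ.* o)
    x^[n+c]≡τ² : ∀ n → x ^ (n ℕ.+ c) ≡ τ n * τ n
    x^[n+c]≡τ² n = ^-distrib-* t t (n ℕ.+ c)
    2^b*[sⱼ-sᵢ]≡ : + (2 ℕ.^ b) * (s j - s i) ≡ a * (τ j * τ j - τ i * τ i)
    2^b*[sⱼ-sᵢ]≡ = trans (scaled-s-difference i j)
                         (cong₂ (λ X Y → a * (X - Y)) (x^[n+c]≡τ² j) (x^[n+c]≡τ² i))
    q∣2^b*[sⱼ-sᵢ] : + suc (2 ℕ.* k) Signed.∣ (+ (2 ℕ.^ b) * (s j - s i))
    q∣2^b*[sⱼ-sᵢ] = subst (_ Signed.∣_) (sym 2^b*[sⱼ-sᵢ]≡)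
                          (Signed.∣n⇒∣m*n a (mirror-≡⇒∣ k (τ i) (τ j) same-residue))

  no-discriminator-below : ∀ {L m n} → 0 < m → m < 2 ℕ.^ suc L → 2 ℕ.^ L < n → ¬ Discriminates m s n
  no-discriminator-below {L} {m} 0<m m<2^[1+L] 2^L<n
    with f , k , refl ← odd-part m 0<m
    with i , j , i<j , j<n , 2^f∣j∸i , same-residue
           ← pigeonhole-mod (2 ℕ.^ f) {{ℕ.m^n≢0 2 f}} (unsigned-residue k) (unsigned-residue-< k)
               (ℕ.≤-<-trans (2^f*[1+2k]<2^[1+L]⇒2^f*[1+k]≤2^L f {k} {L} m<2^[1+L]) 2^L<n)
    = congruent⇒¬discriminates {s = s} i<j j<n (s-congruent {f} {k} i<j 2^f∣j∸i same-residue)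

  2^⌈log₂n⌉≤discriminator : ∀ {n m} → 0 < m → Discriminates m s n → 2 ℕ.^ ⌈log₂ n ⌉ ≤ m
  2^⌈log₂n⌉≤discriminator {n} 0<m discriminates with ⌈log₂ n ⌉ in ⌈log₂n⌉≡
  ... | zero  = 0<m
  ... | suc L = ℕ.≮⇒≥ λ m<2^[1+L] →
    no-discriminator-below {L} 0<m m<2^[1+L] (⌈log₂n⌉≡1+L⇒2^L<n ⌈log₂n⌉≡) discriminates

theorem8 : (a t : ℤ) (c b : ℕ) → Odd a → Odd t → IsLeastNonPM1 t b →
    ∀ n → 1 ℕ.≤ n → IsDiscriminator (seqS a t c b) n (2 ℕ.^ ⌈log₂ n ⌉)
theorem8 a t c b odd-a odd-t b-least n _ with 2≤b , t²-1∥ ← IsLeastNonPM1⇒∥ {t} {b} odd-t b-least =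
  (ℕ.m^n>0 2 ⌈log₂ n ⌉ , 2^E-discriminates {⌈log₂ n ⌉} (n≤2^⌈log₂n⌉ n)) ,
  λ m 0<m → 2^⌈log₂n⌉≤discriminator 0<m
  where open Sequence a t c b odd-a odd-t 2≤b t²-1∥
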